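{- Let $n,k,r$ be positive integers with $r\ge k+1$, and let $T$ be a tree with $k$ edges which is not a star. Let $\mathcal{H}$ be an $r$-uniform multi-hypergraph containing no Berge copy of $T$, and let $S$ be a $(k-1)$-cluster of $\mathcal{H}$. Then every vertex in the span of $S$ that is incident with some hyperedge not belonging to $S$ has degree at most $\lfloor\frac{k-1}{2}\rfloor$ in $\mathcal{H}$.
   Context: A multi-hypergraph may contain repeated hyperedges; it is $r$-uniform if all hyperedges have exactly $r$ vertices. A star is a tree in which one vertex is incident to all edges. For a graph $G$, a multi-hypergraph contains a Berge copy of $G$ if there are an injection $f_1:V(G)\to V(\mathcal{H})$ and an injection $f_2$ from $E(G)$ into the hyperedges of $\mathcal{H}$ (parallel copies count as distinct hyperedges) such that $\{f_1(v_1),f_1(v_2)\}\subseteq f_2(\{v_1,v_2\})$ for every edge $\{v_1,v_2\}$ of $G$. A $(k-1)$-cluster of $\mathcal{H}$ is a set of $k-1$ hyperedges of $\mathcal{H}$ whose common intersection contains at least $k-1$ vertices; this common intersection is the core of the cluster, and the union of the $k-1$ hyperedges is its span. -}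

module Defs where

open import Data.Nat using (ℕ; zero; suc; _≤_)
open import Data.Fin using (Fin; zero; suc; inject₁; fromℕ)
open import Data.Fin.Subset using (Subset; _∈_; _∉_; _⊆_; ∣_∣)
open import Data.Fin.Subset.Properties using (_∈?_)
open import Data.Vec using (tabulate)
open import Data.Product using (_×_; _,_; proj₁; proj₂; ∃; ∃-syntax; Σ)
open import Data.Sum using (_⊎_)
open import Relation.Nullary using (¬_; does)
open import Relation.Binary.PropositionalEquality using (_≡_; _≢_)
open import Function.Definitions using (Injective)

SameEdge : {V : ℕ} → Fin V × Fin V → Fin V × Fin V → Set
SameEdge (a , b) (c , d) = (a ≡ c × b ≡ d) ⊎ (a ≡ d × b ≡ c)

record Graph (V e : ℕ) : Set where
  field
    ends     : Fin e → Fin V × Fin V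
    loopless : ∀ j → proj₁ (ends j) ≢ proj₂ (ends j)
    simple   : ∀ i j → SameEdge (ends i) (ends j) → i ≡ j
open Graph public

Adj : {V e : ℕ} → Graph V e → Fin V → Fin V → Set
Adj G u v = ∃[ j ] SameEdge (ends G j) (u , v)

Walk : {V e : ℕ} → Graph V e → Fin V → Fin V → Set
Walk {V} G x y =
  ∃[ l ] Σ (Fin (suc l) → Fin V) λ p →
    (p zero ≡ x) × (p (fromℕ l) ≡ y) × (∀ (i : Fin l) → Adj G (p (inject₁ i)) (p (suc i)))

Connected : {V e : ℕ} → Graph V e → Set
Connected G = ∀ x y → Walk G x y

-- a cycle: l + 3 ≥ 3 distinct vertices, cyclically consecutive ones adjacent
HasCycle : {V e : ℕ} → Graph V e → Set
HasCycle {V} G =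
  ∃[ l ] Σ (Fin (suc (suc (suc l))) → Fin V) λ c →
    Injective _≡_ _≡_ c ×
    (∀ (i : Fin (suc (suc l))) → Adj G (c (inject₁ i)) (c (suc i))) ×
    Adj G (c (fromℕ (suc (suc l)))) (c zero)

IsTree : {V e : ℕ} → Graph V e → Set
IsTree G = Connected G × ¬ HasCycle G

IsStar : {V e : ℕ} → Graph V e → Set
IsStar {V} {e} G = ∃[ c ] ∀ (j : Fin e) → (proj₁ (ends G j) ≡ c) ⊎ (proj₂ (ends G j) ≡ c)

-- Multi-hypergraphs on vertex set Fin n with m hyperedges indexed by Fin m
-- (repeated hyperedges allowed: distinct indices may carry equal sets).

Hypergraph : ℕ → ℕ → Set
Hypergraph n m = Fin m → Subset n

Uniform : {n m : ℕ} → ℕ → Hypergraph n m → Set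
Uniform r H = ∀ j → ∣ H j ∣ ≡ r

BergeCopy : {V e n m : ℕ} → Graph V e → Hypergraph n m → Set
BergeCopy {V} {e} {n} {m} G H =
  Σ (Fin V → Fin n) λ f₁ → Σ (Fin e → Fin m) λ f₂ →
    Injective _≡_ _≡_ f₁ × Injective _≡_ _≡_ f₂ ×
    (∀ j → (f₁ (proj₁ (ends G j)) ∈ H (f₂ j)) × (f₁ (proj₂ (ends G j)) ∈ H (f₂ j)))

degree : {n m : ℕ} → Hypergraph n m → Fin n → ℕ
degree H v = ∣ tabulate (λ j → does (v ∈? H j)) ∣

IsCluster : {n m : ℕ} → ℕ → Hypergraph n m → Subset m → Set
IsCluster {n} t H S =
  ∣ S ∣ ≡ t × ∃[ C ] (t ≤ ∣ C ∣ × (∀ j → j ∈ S → C ⊆ H j))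

InSpan : {n m : ℕ} → Hypergraph n m → Subset m → Fin n → Set
InSpan H S v = ∃[ j ] (j ∈ S × v ∈ H j)

module Submission where

open import Defs
open import Data.Nat using (ℕ; _≤_; _+_; _∸_; _/_)
open import Data.Fin using (Fin)
open import Data.Fin.Subset using (Subset; _∈_; _∉_)
open import Data.Product using (_×_; ∃-syntax)
open import Relation.Nullary using (¬_)

-- A tree that is not a star has two distinct
-- outermost inner vertices (the ends of a maximal path of inner vertices):
-- all edges at such a vertex except one, its spine, lead to leaves. Two
-- distinct vertices share at most one edge, so one of them, w, has degree at
-- most ⌊(k - 1)/2⌋ + 1 ≤ deg v. Then T has a Berge copy: w ↦ v, the spine ↦ e,
-- another edge at w (the twig) ↦ h, the remaining edges at w ↦ further
-- hyperedges at v, the edges away from w ↦ unused members of S, the other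
-- inner vertices ↦ vertices of the core C (which lies in every member of S),
-- and each leaf ↦ a fresh vertex of the image of its edge, possible since T
-- has at most k + 1 ≤ r vertices. Each of these choices is a greedy system of
-- distinct representatives, and the vertex and edge maps are glued together
-- from injective pieces with disjoint images.

open import Data.Nat using (zero; suc; _*_; _<_; _≤?_; z≤n; s≤s)
open import Data.Nat.Properties
  using (≤-refl; ≤-trans; ≤-reflexive; ≤-pred; <-irrefl; <-trans; <⇒≤; ≰⇒>; >⇒≢; m≤n⇒m<n∨m≡n;
         +-comm; +-assoc; +-suc; +-identityʳ; *-comm; m≤m+n; +-mono-≤; +-monoʳ-≤; +-monoˡ-≤; +-cancelʳ-≤;
         ∸-monoʳ-≤; ∸-+-assoc; m≤n+o⇒m∸n≤o; m∸n+n≡m; m+[n∸m]≡n; module ≤-Reasoning)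
open import Data.Nat.DivMod using (m*n/n≡m; /-monoˡ-≤; m/n≡1+[m∸n]/n)
open import Data.Bool using (true; false)
open import Data.Fin using (zero; suc; _≟_; fromℕ; fromℕ<; inject₁; punchIn)
open import Data.Fin.Properties using (any?; all?; ¬∀⟶∃¬; injective⇒≤; punchIn-injective; punchInᵢ≢i)
open import Data.Fin.Subset using (∣_∣; _⊆_; _∪_; _∩_; _─_; _-_; ⁅_⁆; ∁; ⊥; Nonempty)
open import Data.Fin.Subset.Properties
  using (_∈?_; nonempty?; Empty-unique; ∣⊥∣≡0; ∣⁅x⁆∣≡1; x∈⁅x⁆; ∣p∣≤n; ∣p∩q∣≤∣q∣; ∣∁p∣≡n∸∣p∣;
         p⊆q⇒∣p∣≤∣q∣; x∈p⇒∣p-x∣<∣p∣; x∈p∧x≢y⇒x∈p-y; p─q⊆p; p─q─r≡p─q∪r; p⊆p∪q; q⊆p∪q;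
         x∈p∩q⁻; x∉p⇒x∈∁p)
open import Data.Vec using (_∷_; []; here; there; tabulate)
open import Data.Vec.Properties using (lookup∘tabulate; lookup⇒[]=; []=⇒lookup)
open import Data.List using (List; []; _∷_; _++_; [_]; length; lookup)
open import Data.List.Properties using (++-assoc)
open import Data.List.Relation.Unary.All as All using (All; []; _∷_)
open import Data.List.Relation.Unary.All.Properties using (¬Any⇒All¬; ++⁻ˡ)
open import Data.List.Relation.Unary.AllPairs using ([]; _∷_)
open import Data.List.Relation.Unary.Unique.Propositional using (Unique)
open import Data.List.Relation.Unary.Linked using (Linked; []; [-]; _∷_)
open import Data.List.Relation.Unary.Any using (here; there)
open import Data.List.Membership.Propositional using () renaming (_∈_ to _∈ₗ_)
open import Data.List.Membership.Propositional.Properties using (∈-∃++; ∈-lookup)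
open import Data.Product using (_,_; proj₁; proj₂; Σ)
open import Data.Sum using (_⊎_; inj₁; inj₂)
open import Data.Unit using (⊤; tt)
open import Data.Empty using (⊥-elim)
open import Relation.Nullary using (Dec; yes; no; does; contradiction)
open import Relation.Nullary.Decidable using (dec-true; _×-dec_; _⊎-dec_; _→-dec_; ¬?; map′)
open import Relation.Unary using (Pred; Decidable)
open import Relation.Binary.PropositionalEquality using (_≡_; _≢_; refl; sym; trans; cong; cong₂; subst; module ≡-Reasoning)
open import Function using (_∘_)

∣p∪q∣+∣p∩q∣≡∣p∣+∣q∣ : ∀ {n} (p q : Subset n) → ∣ p ∪ q ∣ + ∣ p ∩ q ∣ ≡ ∣ p ∣ + ∣ q ∣
∣p∪q∣+∣p∩q∣≡∣p∣+∣q∣ [] [] = refl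
∣p∪q∣+∣p∩q∣≡∣p∣+∣q∣ (true ∷ p) (true ∷ q) = cong suc (begin
  ∣ p ∪ q ∣ + suc ∣ p ∩ q ∣  ≡⟨ +-suc _ _ ⟩
  suc (∣ p ∪ q ∣ + ∣ p ∩ q ∣) ≡⟨ cong suc (∣p∪q∣+∣p∩q∣≡∣p∣+∣q∣ p q) ⟩
  suc (∣ p ∣ + ∣ q ∣)         ≡⟨ +-suc _ _ ⟨
  ∣ p ∣ + suc ∣ q ∣           ∎)
  where open ≡-Reasoning
∣p∪q∣+∣p∩q∣≡∣p∣+∣q∣ (true ∷ p) (false ∷ q) = cong suc (∣p∪q∣+∣p∩q∣≡∣p∣+∣q∣ p q)
∣p∪q∣+∣p∩q∣≡∣p∣+∣q∣ (false ∷ p) (true ∷ q) =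
  trans (cong suc (∣p∪q∣+∣p∩q∣≡∣p∣+∣q∣ p q)) (sym (+-suc _ _))
∣p∪q∣+∣p∩q∣≡∣p∣+∣q∣ (false ∷ p) (false ∷ q) = ∣p∪q∣+∣p∩q∣≡∣p∣+∣q∣ p q

∣p∪q∣≤∣p∣+∣q∣ : ∀ {n} (p q : Subset n) → ∣ p ∪ q ∣ ≤ ∣ p ∣ + ∣ q ∣
∣p∪q∣≤∣p∣+∣q∣ p q = ≤-trans (m≤m+n _ _) (≤-reflexive (∣p∪q∣+∣p∩q∣≡∣p∣+∣q∣ p q))

∣p─q∣+∣p∩q∣≡∣p∣ : ∀ {n} (p q : Subset n) → ∣ p ─ q ∣ + ∣ p ∩ q ∣ ≡ ∣ p ∣
∣p─q∣+∣p∩q∣≡∣p∣ [] [] = refl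
∣p─q∣+∣p∩q∣≡∣p∣ (true ∷ p) (true ∷ q) = trans (+-suc _ _) (cong suc (∣p─q∣+∣p∩q∣≡∣p∣ p q))
∣p─q∣+∣p∩q∣≡∣p∣ (true ∷ p) (false ∷ q) = cong suc (∣p─q∣+∣p∩q∣≡∣p∣ p q)
∣p─q∣+∣p∩q∣≡∣p∣ (false ∷ p) (true ∷ q) = ∣p─q∣+∣p∩q∣≡∣p∣ p q
∣p─q∣+∣p∩q∣≡∣p∣ (false ∷ p) (false ∷ q) = ∣p─q∣+∣p∩q∣≡∣p∣ p q

∣p∣≤∣p─q∣+∣q∣ : ∀ {n} (p q : Subset n) → ∣ p ∣ ≤ ∣ p ─ q ∣ + ∣ q ∣
∣p∣≤∣p─q∣+∣q∣ p q = begin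
  ∣ p ∣               ≡⟨ ∣p─q∣+∣p∩q∣≡∣p∣ p q ⟨
  ∣ p ─ q ∣ + ∣ p ∩ q ∣ ≤⟨ +-monoʳ-≤ ∣ p ─ q ∣ (∣p∩q∣≤∣q∣ p q) ⟩
  ∣ p ─ q ∣ + ∣ q ∣   ∎
  where open ≤-Reasoning

x∈p─q⇒x∉q : ∀ {n} (p q : Subset n) {x} → x ∈ p ─ q → x ∉ q
x∈p─q⇒x∉q (true ∷ p) (false ∷ q) here ()
x∈p─q⇒x∉q (_ ∷ p) (_ ∷ q) (there x∈) (there x∈q) = x∈p─q⇒x∉q p q x∈ x∈q

∣p∣>0⇒nonempty : ∀ {n} (p : Subset n) → 0 < ∣ p ∣ → Nonempty p
∣p∣>0⇒nonempty {n} p 0<∣p∣ with nonempty? p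
... | yes ne = ne
... | no ¬ne = contradiction (trans (cong ∣_∣ (Empty-unique ¬ne)) (∣⊥∣≡0 n)) (>⇒≢ 0<∣p∣)

∣p∣≤1 : ∀ {n} (p : Subset n) → (∀ {x y} → x ∈ p → y ∈ p → x ≡ y) → ∣ p ∣ ≤ 1
∣p∣≤1 {n} p allEqual with nonempty? p
... | no ¬ne = ≤-trans (≤-reflexive (trans (cong ∣_∣ (Empty-unique ¬ne)) (∣⊥∣≡0 n))) z≤n
... | yes (x , x∈p) = ≤-trans (p⊆q⇒∣p∣≤∣q∣ p⊆⁅x⁆) (≤-reflexive (∣⁅x⁆∣≡1 x))
  where
  p⊆⁅x⁆ : p ⊆ ⁅ x ⁆
  p⊆⁅x⁆ y∈p = subst (_∈ ⁅ x ⁆) (allEqual x∈p y∈p) (x∈⁅x⁆ x)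

2≤∣p∣ : ∀ {n} {p : Subset n} {x y} → x ∈ p → y ∈ p → x ≢ y → 2 ≤ ∣ p ∣
2≤∣p∣ {p = p} {x} {y} x∈p y∈p x≢y =
  ≤-trans (s≤s (≤-trans (s≤s z≤n) (x∈p⇒∣p-x∣<∣p∣ y∈p-x))) (x∈p⇒∣p-x∣<∣p∣ x∈p)
  where
  y∈p-x : y ∈ p - x
  y∈p-x = x∈p∧x≢y⇒x∈p-y y∈p (x≢y ∘ sym)

∣⁅x⁆∪p∣≤1+∣p∣ : ∀ {n} (x : Fin n) (p : Subset n) → ∣ ⁅ x ⁆ ∪ p ∣ ≤ suc ∣ p ∣
∣⁅x⁆∪p∣≤1+∣p∣ x p = ≤-trans (∣p∪q∣≤∣p∣+∣q∣ ⁅ x ⁆ p) (≤-reflexive (cong (_+ ∣ p ∣) (∣⁅x⁆∣≡1 x)))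

⟦_⟧ : ∀ {n ℓ} {P : Pred (Fin n) ℓ} → Decidable P → Subset n
⟦ P? ⟧ = tabulate (does ∘ P?)

module _ {n ℓ} {P : Pred (Fin n) ℓ} (P? : Decidable P) where

  ∈⟦⟧⁺ : ∀ {x} → P x → x ∈ ⟦ P? ⟧
  ∈⟦⟧⁺ {x} px = lookup⇒[]= x _ (trans (lookup∘tabulate _ x) (dec-true (P? x) px))

  ∈⟦⟧⁻ : ∀ {x} → x ∈ ⟦ P? ⟧ → P x
  ∈⟦⟧⁻ {x} x∈ = witness (P? x) (trans (sym (lookup∘tabulate _ x)) ([]=⇒lookup x∈))
    where
    witness : (d : Dec (P x)) → does d ≡ true → P x
    witness (yes px) _ = px

-- A system of distinct representatives: for every j ∈ P an element pick j of
-- Q j outside the forbidden set X, injectively, all inside a set used of size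
-- at most ∣ P ∣ (so that later choices can be made to avoid them).
record Representatives {k m} (P : Subset k) (Q : Fin k → Subset m) (X : Subset m) : Set where
  field
    pick           : Fin k → Fin m
    used           : Subset m
    ∣used∣≤∣P∣      : ∣ used ∣ ≤ ∣ P ∣
    pick∈Q         : ∀ {j} → j ∈ P → pick j ∈ Q j
    pick∉X         : ∀ {j} → j ∈ P → pick j ∉ X
    pick∈used      : ∀ {j} → j ∈ P → pick j ∈ used
    pick-injective : ∀ {i j} → i ∈ P → j ∈ P → pick i ≡ pick j → i ≡ j

-- Greedy choice (Hall's condition in its trivial form): if every Q j has at
-- least ∣ P ∣ elements outside X, distinct representatives exist. The element
-- d only fills in the irrelevant values of pick outside P.
representatives : ∀ {k m} (d : Fin m) (P : Subset k) (Q : Fin k → Subset m) (X : Subset m) →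
                  (∀ {j} → j ∈ P → ∣ P ∣ ≤ ∣ Q j ─ X ∣) → Representatives P Q X
representatives {m = m} d [] Q X large = record
  { pick = λ () ; used = ⊥ ; ∣used∣≤∣P∣ = ≤-reflexive (∣⊥∣≡0 m)
  ; pick∈Q = λ () ; pick∉X = λ () ; pick∈used = λ () ; pick-injective = λ () }
representatives d (false ∷ P) Q X large = record
  { pick = λ { zero → d ; (suc j) → pick j } ; used = used ; ∣used∣≤∣P∣ = ∣used∣≤∣P∣
  ; pick∈Q = λ { (there j∈P) → pick∈Q j∈P }
  ; pick∉X = λ { (there j∈P) → pick∉X j∈P }
  ; pick∈used = λ { (there j∈P) → pick∈used j∈P }
  ; pick-injective = λ { (there i∈P) (there j∈P) eq → cong suc (pick-injective i∈P j∈P eq) } }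
  where open Representatives (representatives d P (Q ∘ suc) X (large ∘ there))
representatives {m = m} d (true ∷ P) Q X large = record
  { pick = λ { zero → x ; (suc j) → pick j }
  ; used = ⁅ x ⁆ ∪ used
  ; ∣used∣≤∣P∣ = ≤-trans (∣⁅x⁆∪p∣≤1+∣p∣ x used) (s≤s ∣used∣≤∣P∣)
  ; pick∈Q = λ { here → proj₁ x∈Q₀∖X ; (there j∈P) → pick∈Q j∈P }
  ; pick∉X = λ { here → proj₂ x∈Q₀∖X ; (there j∈P) → pick∉X j∈P ∘ p⊆p∪q ⁅ x ⁆ }
  ; pick∈used = λ { here → p⊆p∪q used (x∈⁅x⁆ x) ; (there j∈P) → q⊆p∪q ⁅ x ⁆ used (pick∈used j∈P) }
  ; pick-injective = λ
      { here here _ → refl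
      ; here (there j∈P) eq → ⊥-elim (pick-avoids-x j∈P (sym eq))
      ; (there i∈P) here eq → ⊥-elim (pick-avoids-x i∈P eq)
      ; (there i∈P) (there j∈P) eq → cong suc (pick-injective i∈P j∈P eq) } }
  where
  candidate : Nonempty (Q zero ─ X)
  candidate = ∣p∣>0⇒nonempty (Q zero ─ X) (≤-trans (s≤s z≤n) (large here))

  x : Fin m
  x = proj₁ candidate

  x∈Q₀∖X : x ∈ Q zero × x ∉ X
  x∈Q₀∖X = p─q⊆p (Q zero) X (proj₂ candidate) , x∈p─q⇒x∉q (Q zero) X (proj₂ candidate)

  room : ∀ {j} → j ∈ P → ∣ P ∣ ≤ ∣ Q (suc j) ─ (X ∪ ⁅ x ⁆) ∣
  room {j} j∈P = ≤-pred (begin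
    suc ∣ P ∣                         ≤⟨ large (there j∈P) ⟩
    ∣ Q (suc j) ─ X ∣                  ≤⟨ ∣p∣≤∣p─q∣+∣q∣ (Q (suc j) ─ X) ⁅ x ⁆ ⟩
    ∣ Q (suc j) ─ X ─ ⁅ x ⁆ ∣ + ∣ ⁅ x ⁆ ∣ ≡⟨ cong₂ _+_ (cong ∣_∣ (p─q─r≡p─q∪r (Q (suc j)) X ⁅ x ⁆)) (∣⁅x⁆∣≡1 x) ⟩
    ∣ Q (suc j) ─ (X ∪ ⁅ x ⁆) ∣ + 1   ≡⟨ +-comm _ 1 ⟩
    suc ∣ Q (suc j) ─ (X ∪ ⁅ x ⁆) ∣   ∎)
    where open ≤-Reasoning

  open Representatives (representatives d P (Q ∘ suc) (X ∪ ⁅ x ⁆) room)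

  pick-avoids-x : ∀ {j} → j ∈ P → pick j ≢ x
  pick-avoids-x j∈P eq = pick∉X j∈P (subst (_∈ X ∪ ⁅ x ⁆) (sym eq) (q⊆p∪q X ⁅ x ⁆ (x∈⁅x⁆ x)))

module _ {A B : Set} where

  InjectiveOn : (A → Set) → (A → B) → Set
  InjectiveOn D f = ∀ {x y} → D x → D y → f x ≡ f y → x ≡ y

  glue : {P : A → Set} → Decidable P → (A → B) → (A → B) → A → B
  glue P? f g x with P? x
  ... | yes _ = f x
  ... | no  _ = g x

  module _ {P : A → Set} (P? : Decidable P) {f g : A → B} where

    glue-injective : {D : A → Set} →
      InjectiveOn (λ x → D x × P x) f → InjectiveOn (λ x → D x × ¬ P x) g →
      (∀ {x y} → D x → P x → D y → ¬ P y → f x ≢ g y) →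
      InjectiveOn D (glue P? f g)
    glue-injective f-inj g-inj apart {x} {y} dx dy eq with P? x | P? y
    ... | yes px | yes py = f-inj (dx , px) (dy , py) eq
    ... | yes px | no ¬py = ⊥-elim (apart dx px dy ¬py eq)
    ... | no ¬px | yes py = ⊥-elim (apart dy py dx ¬px (sym eq))
    ... | no ¬px | no ¬py = g-inj (dx , ¬px) (dy , ¬py) eq

module Incidence {V k : ℕ} (T : Graph V k) where

  Inc : Fin V → Fin k → Set
  Inc x j = proj₁ (ends T j) ≡ x ⊎ proj₂ (ends T j) ≡ x

  inc? : ∀ x j → Dec (Inc x j)
  inc? x j = (proj₁ (ends T j) ≟ x) ⊎-dec (proj₂ (ends T j) ≟ x)

  adj? : ∀ x y → Dec (Adj T x y)
  adj? x y = any? λ j → same? (ends T j) (x , y)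
    where
    same? : (p q : Fin V × Fin V) → Dec (SameEdge p q)
    same? (a , b) (c , d) = ((a ≟ c) ×-dec (b ≟ d)) ⊎-dec ((a ≟ d) ×-dec (b ≟ c))

  same-sym : ∀ {p : Fin V × Fin V} {x y} → SameEdge p (x , y) → SameEdge p (y , x)
  same-sym (inj₁ (a , b)) = inj₂ (a , b)
  same-sym (inj₂ (a , b)) = inj₁ (a , b)

  adj-sym : ∀ {x y} → Adj T x y → Adj T y x
  adj-sym (j , s) = j , same-sym s

  adj-irrefl : ∀ {x} → ¬ Adj T x x
  adj-irrefl (j , inj₁ (a , b)) = loopless T j (trans a (sym b))
  adj-irrefl (j , inj₂ (a , b)) = loopless T j (trans a (sym b))

  same⇒inc : ∀ {j x y} → SameEdge (ends T j) (x , y) → Inc x j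
  same⇒inc (inj₁ (a , _)) = inj₁ a
  same⇒inc (inj₂ (_ , b)) = inj₂ b

  inc⇒same : ∀ {j x y} → Inc x j → Inc y j → x ≢ y → SameEdge (ends T j) (x , y)
  inc⇒same (inj₁ a) (inj₁ b) x≢y = ⊥-elim (x≢y (trans (sym a) b))
  inc⇒same (inj₁ a) (inj₂ b) x≢y = inj₁ (a , b)
  inc⇒same (inj₂ a) (inj₁ b) x≢y = inj₂ (b , a)
  inc⇒same (inj₂ a) (inj₂ b) x≢y = ⊥-elim (x≢y (trans (sym a) b))

  third-endpoint : ∀ {j a b c} → Inc a j → Inc b j → a ≢ b → Inc c j → c ≡ a ⊎ c ≡ b
  third-endpoint ia ib a≢b ic with inc⇒same ia ib a≢b | ic
  ... | inj₁ (p , q) | inj₁ r = inj₁ (trans (sym r) p)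
  ... | inj₁ (p , q) | inj₂ r = inj₂ (trans (sym r) q)
  ... | inj₂ (p , q) | inj₁ r = inj₂ (trans (sym r) p)
  ... | inj₂ (p , q) | inj₂ r = inj₁ (trans (sym r) q)

  same-edge : ∀ {i j x y} → SameEdge (ends T i) (x , y) → SameEdge (ends T j) (x , y) → i ≡ j
  same-edge {i} {j} (inj₁ (a , b)) (inj₁ (c , d)) = simple T i j (inj₁ (trans a (sym c) , trans b (sym d)))
  same-edge {i} {j} (inj₁ (a , b)) (inj₂ (c , d)) = simple T i j (inj₂ (trans a (sym d) , trans b (sym c)))
  same-edge {i} {j} (inj₂ (a , b)) (inj₁ (c , d)) = simple T i j (inj₂ (trans a (sym d) , trans b (sym c)))
  same-edge {i} {j} (inj₂ (a , b)) (inj₂ (c , d)) = simple T i j (inj₁ (trans a (sym c) , trans b (sym d)))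

  other-end : ∀ {j x y z} → SameEdge (ends T j) (x , y) → SameEdge (ends T j) (x , z) → y ≡ z
  other-end (inj₁ (a , b)) (inj₁ (c , d)) = trans (sym b) d
  other-end (inj₁ (a , b)) (inj₂ (c , d)) = trans (sym b) (trans d (trans (sym a) c))
  other-end (inj₂ (a , b)) (inj₁ (c , d)) = trans (sym a) (trans c (trans (sym b) d))
  other-end (inj₂ (a , b)) (inj₂ (c , d)) = trans (sym a) c

  partner : ∀ {j x} → Inc x j → Σ (Fin V) λ y → Inc y j × y ≢ x
  partner {j} (inj₁ e) = proj₂ (ends T j) , inj₂ refl , λ q → loopless T j (trans e (sym q))
  partner {j} (inj₂ e) = proj₁ (ends T j) , inj₁ refl , λ q → loopless T j (trans q (sym e))

  Leaf : Fin V → Set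
  Leaf x = Σ (Fin k) λ j → Inc x j × (∀ i → Inc x i → i ≡ j)

  Inner : Fin V → Set
  Inner x = ¬ Leaf x

  leaf? : ∀ x → Dec (Leaf x)
  leaf? x = any? λ j → inc? x j ×-dec all? (λ i → inc? x i →-dec (i ≟ j))

  leaf-edge : ∀ {x i j} → Leaf x → Inc x i → Inc x j → i ≡ j
  leaf-edge (e , _ , unique) xi xj = trans (unique _ xi) (sym (unique _ xj))

  leaf-neighbour : ∀ {x y z} → Leaf x → Adj T x y → Adj T x z → y ≡ z
  leaf-neighbour l (i , si) (j , sj) with leaf-edge l (same⇒inc si) (same⇒inc sj)
  ... | refl = other-end si sj

module Walks {V k : ℕ} (T : Graph V k) where
  open Incidence T

  data Reach : ℕ → Fin V → Fin V → Set where
    stay : ∀ {x} → Reach 0 x x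
    step : ∀ {n x y z} → Adj T x y → Reach n y z → Reach (suc n) x z

  walk⇒reach : ∀ {x y} → Walk T x y → Σ ℕ λ l → Reach l x y
  walk⇒reach (l , p , refl , refl , adjacent) = l , along l p adjacent
    where
    along : ∀ l (p : Fin (suc l) → Fin V) → (∀ i → Adj T (p (inject₁ i)) (p (suc i))) →
            Reach l (p zero) (p (fromℕ l))
    along zero p _ = stay
    along (suc l) p adjacent = step (adjacent zero) (along l (p ∘ suc) (adjacent ∘ suc))

  reach? : ∀ n x z → Dec (Reach n x z)
  reach? zero x z = map′ (λ { refl → stay }) (λ { stay → refl }) (x ≟ z)
  reach? (suc n) x z = map′ (λ { (y , a , r) → step a r }) (λ { (step a r) → _ , a , r })
                            (any? λ y → adj? x y ×-dec reach? n y z)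

least : (P : ℕ → Set) → (∀ n → Dec (P n)) → ∀ l → P l →
        Σ ℕ λ n → P n × (∀ m → m < n → ¬ P m)
least P P? l pl with search (suc l)
  where
  search : ∀ b → (Σ ℕ λ n → P n × (∀ m → m < n → ¬ P m)) ⊎ (∀ m → m < b → ¬ P m)
  search zero = inj₂ (λ _ ())
  search (suc b) with search b
  ... | inj₁ found = inj₁ found
  ... | inj₂ none with P? b
  ...   | yes pb = inj₁ (b , pb , none)
  ...   | no ¬pb = inj₂ λ m m<1+b → below (m≤n⇒m<n∨m≡n (≤-pred m<1+b))
    where
    below : ∀ {m} → m < b ⊎ m ≡ b → ¬ P m
    below (inj₁ m<b) = none _ m<b
    below (inj₂ refl) = ¬pb
... | inj₁ found = found
... | inj₂ none = ⊥-elim (none l ≤-refl pl)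

-- A connected graph with k edges has at most k + 1 vertices: choosing a
-- root ρ, every other vertex x has a "parent edge" to a neighbour closer to
-- ρ, and distinct vertices have distinct parent edges.
vertices≤edges+1 : ∀ {V k} (T : Graph V k) → Connected T → Fin V → V ≤ suc k
vertices≤edges+1 {suc V} {k} T conn ρ = s≤s (injective⇒≤ parentOf-injective)
  where
  open Incidence T
  open Walks T

  shortest : (x : Fin (suc V)) → Σ ℕ λ d → Reach d x ρ × (∀ m → m < d → ¬ Reach m x ρ)
  shortest x = least (λ n → Reach n x ρ) (λ n → reach? n x ρ) _ (proj₂ (walk⇒reach (conn x ρ)))

  dist : Fin (suc V) → ℕ
  dist x = proj₁ (shortest x)

  dist-minimal : ∀ {x m} → Reach m x ρ → dist x ≤ m
  dist-minimal {x} {m} r with dist x ≤? m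
  ... | yes d≤m = d≤m
  ... | no d≰m = ⊥-elim (proj₂ (proj₂ (shortest x)) m (≰⇒> d≰m) r)

  Parent : Fin (suc V) → Set
  Parent x = Σ (Fin k) λ j → Σ (Fin (suc V)) λ y → SameEdge (ends T j) (x , y) × dist y < dist x

  parent : ∀ x → x ≢ ρ → Parent x
  parent x x≢ρ with shortest x
  ... | zero , stay , _ = ⊥-elim (x≢ρ refl)
  ... | suc d , step (j , s) r , _ = j , _ , s , s≤s (dist-minimal r)

  -- both ends of a shared parent edge would be closer to ρ than each other
  parent-injective : ∀ {x x'} (p : Parent x) (p' : Parent x') → proj₁ p ≡ proj₁ p' → x ≡ x'
  parent-injective {x} {x'} (j , y , s , y<x) (.j , y' , s' , y'<x') refl with x ≟ x'
  ... | yes x≡x' = x≡x'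
  ... | no x≢x' = ⊥-elim (<-irrefl refl (<-trans x'<x x<x'))
    where
    x'<x : dist x' < dist x
    x'<x = subst (λ t → dist t < dist x) (other-end s (inc⇒same (same⇒inc s) (same⇒inc s') x≢x')) y<x
    x<x' : dist x < dist x'
    x<x' = subst (λ t → dist t < dist x')
             (other-end s' (inc⇒same (same⇒inc s') (same⇒inc s) (x≢x' ∘ sym))) y'<x'

  parentOf : Fin V → Fin k
  parentOf i = proj₁ (parent (punchIn ρ i) (punchInᵢ≢i ρ i))

  parentOf-injective : ∀ {i j} → parentOf i ≡ parentOf j → i ≡ j
  parentOf-injective {i} {j} eq = punchIn-injective ρ i j (parent-injective (parent _ _) (parent _ _) eq)

module _ {A : Set} where

  Unique-prefix : ∀ xs {ys : List A} → Unique (xs ++ ys) → Unique xs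
  Unique-prefix [] _ = []
  Unique-prefix (x ∷ xs) (x∉ ∷ u) = ++⁻ˡ xs x∉ ∷ Unique-prefix xs u

  Linked-prefix : ∀ {R : A → A → Set} xs {ys} → Linked R (xs ++ ys) → Linked R xs
  Linked-prefix [] _ = []
  Linked-prefix (x ∷ []) _ = [-]
  Linked-prefix (x ∷ y ∷ zs) (r ∷ l) = r ∷ Linked-prefix (y ∷ zs) l

  lookup-linked : ∀ {R : A → A → Set} {x xs} → Linked R (x ∷ xs) →
                  ∀ (i : Fin (length xs)) → R (lookup (x ∷ xs) (inject₁ i)) (lookup (x ∷ xs) (suc i))
  lookup-linked (r ∷ _) zero = r
  lookup-linked (_ ∷ l) (suc i) = lookup-linked l i

  lookup-last : ∀ (x : A) zs y → lookup (x ∷ zs ++ [ y ]) (fromℕ (length (zs ++ [ y ]))) ≡ y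
  lookup-last x [] y = refl
  lookup-last x (z ∷ zs) y = lookup-last z zs y

  lookup-injective : ∀ {xs : List A} → Unique xs → ∀ {i j} → lookup xs i ≡ lookup xs j → i ≡ j
  lookup-injective (_ ∷ _) {zero} {zero} _ = refl
  lookup-injective (x∉ ∷ _) {zero} {suc j} eq = ⊥-elim (All.lookup x∉ (∈-lookup j) eq)
  lookup-injective (x∉ ∷ _) {suc i} {zero} eq = ⊥-elim (All.lookup x∉ (∈-lookup i) (sym eq))
  lookup-injective (_ ∷ u) {suc i} {suc j} eq = cong suc (lookup-injective u eq)

module Stars {V k : ℕ} (T : Graph V k) where
  open Incidence T
  open Walks T

  EveryEdgeHasLeaf : Set
  EveryEdgeHasLeaf = ∀ j → Leaf (proj₁ (ends T j)) ⊎ Leaf (proj₂ (ends T j))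

  module _ (leafy : EveryEdgeHasLeaf) where

    leafy-ends : ∀ {j a b} → SameEdge (ends T j) (a , b) → Leaf a ⊎ Leaf b
    leafy-ends {j} (inj₁ (p , q)) with leafy j
    ... | inj₁ l = inj₁ (subst Leaf p l)
    ... | inj₂ l = inj₂ (subst Leaf q l)
    leafy-ends {j} (inj₂ (p , q)) with leafy j
    ... | inj₁ l = inj₂ (subst Leaf p l)
    ... | inj₂ l = inj₁ (subst Leaf q l)

    module _ {x y : Fin V} {j₀ : Fin k} (x~y : SameEdge (ends T j₀) (x , y)) (leaf-x : Leaf x) where

      -- induction along a walk from a to y: the next vertex b is y or a
      -- neighbour of y; in the latter case b or y is a leaf, forcing a = y
      near : ∀ {n a} → Reach n a y → a ≡ y ⊎ Adj T a y
      near stay = inj₁ refl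
      near (step a~b r) with near r
      ... | inj₁ refl = inj₂ a~b
      ... | inj₂ (j , b~y) with leafy-ends b~y
      ...   | inj₁ leaf-b = inj₁ (leaf-neighbour leaf-b (adj-sym a~b) (j , b~y))
      ...   | inj₂ leaf-y with leaf-neighbour leaf-y (adj-sym (j , b~y)) (j₀ , same-sym x~y)
      ...     | refl = inj₁ (leaf-neighbour leaf-x (adj-sym a~b) (j , b~y))

      centre : Connected T → IsStar T
      centre conn = y , λ j → at-y j (proj₁ (ends T j) ≟ y) (proj₂ (ends T j) ≟ y)
        where
        near-y : ∀ a → a ≡ y ⊎ Adj T a y
        near-y a = near (proj₂ (walk⇒reach (conn a y)))
        -- an edge missing y would join two neighbours of y, one of them a leaf
        at-y : ∀ j → Dec (proj₁ (ends T j) ≡ y) → Dec (proj₂ (ends T j) ≡ y) →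
               proj₁ (ends T j) ≡ y ⊎ proj₂ (ends T j) ≡ y
        at-y j (yes p) _ = inj₁ p
        at-y j (no _) (yes q) = inj₂ q
        at-y j (no ¬p) (no ¬q) with near-y (proj₁ (ends T j)) | near-y (proj₂ (ends T j)) | leafy j
        ... | inj₁ e | _ | _ = ⊥-elim (¬p e)
        ... | _ | inj₁ e | _ = ⊥-elim (¬q e)
        ... | inj₂ p~y | inj₂ _ | inj₁ l = ⊥-elim (¬q (sym (leaf-neighbour l p~y (j , inj₁ (refl , refl)))))
        ... | inj₂ _ | inj₂ q~y | inj₂ l = ⊥-elim (¬p (sym (leaf-neighbour l q~y (j , inj₂ (refl , refl)))))

    leafy⇒star : Connected T → 1 ≤ k → IsStar T
    leafy⇒star conn 1≤k with fromℕ< 1≤k | leafy (fromℕ< 1≤k)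
    ... | j | inj₁ l = centre {j₀ = j} (inj₁ (refl , refl)) l conn
    ... | j | inj₂ l = centre {j₀ = j} (inj₂ (refl , refl)) l conn

  has-leaf? : ∀ j → Dec (Leaf (proj₁ (ends T j)) ⊎ Leaf (proj₂ (ends T j)))
  has-leaf? j = leaf? (proj₁ (ends T j)) ⊎-dec leaf? (proj₂ (ends T j))

  inner-edge : Connected T → 1 ≤ k → ¬ IsStar T →
               Σ (Fin k) λ j → Inner (proj₁ (ends T j)) × Inner (proj₂ (ends T j))
  inner-edge conn 1≤k not-star with all? has-leaf?
  ... | yes leafy = ⊥-elim (not-star (leafy⇒star leafy conn 1≤k))
  ... | no ¬leafy with ¬∀⟶∃¬ k _ has-leaf? ¬leafy
  ...   | j , no-leaf = j , no-leaf ∘ inj₁ , no-leaf ∘ inj₂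

module _ {V k : ℕ} (T : Graph V k) where
  open Incidence T

  record Outermost (w : Fin V) : Set where
    field
      spine twig : Fin k
      spine-inc  : Inc w spine
      twig-inc   : Inc w twig
      twig≢spine : twig ≢ spine
      leafy      : ∀ {j y} → Inc w j → j ≢ spine → Inc y j → y ≢ w → Leaf y

module _ {V k : ℕ} {T : Graph V k} {w : Fin V} (o : Outermost T w) where
  open Incidence T
  open Outermost o

  outermost-inner : Inner w
  outermost-inner leaf-w = twig≢spine (leaf-edge leaf-w twig-inc spine-inc)

  twig-leaf : Σ (Fin V) λ z → Inc z twig × z ≢ w × Leaf z
  twig-leaf with partner twig-inc
  ... | z , z-inc , z≢w = z , z-inc , z≢w , leafy twig-inc twig≢spine z-inc z≢w

-- Paths of inner vertices in an acyclic graph, listed from their free end.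
module InnerPaths {V k : ℕ} (T : Graph V k) (acyclic : ¬ HasCycle T) where
  open Incidence T
  open import Data.List.Membership.DecPropositional (_≟_ {n = V}) using () renaming (_∈?_ to _∈ₗ?_)

  InnerPath : List (Fin V) → Set
  InnerPath xs = Unique xs × Linked (Adj T) xs × All Inner xs

  Maximal : Fin V → List (Fin V) → Set
  Maximal a xs = ∀ {y} → Inner y → Adj T a y → y ∈ₗ xs

  unique-length : ∀ {xs : List (Fin V)} → Unique xs → length xs ≤ V
  unique-length u = injective⇒≤ (lookup-injective u)

  close : ∀ a b mid y → Unique (a ∷ b ∷ mid ++ [ y ]) → Linked (Adj T) (a ∷ b ∷ mid ++ [ y ]) →
          Adj T y a → HasCycle T
  close a b [] y u l y~a = 0 , lookup (a ∷ b ∷ y ∷ []) , lookup-injective u , lookup-linked l , y~a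
  close a b (q ∷ mid) y u l y~a =
    length (mid ++ [ y ]) , lookup (a ∷ b ∷ q ∷ mid ++ [ y ]) , lookup-injective u , lookup-linked l ,
    subst (λ t → Adj T t a) (sym (lookup-last q mid y)) y~a

  maximal-head : ∀ {a b rest y} → InnerPath (a ∷ b ∷ rest) → Maximal a (a ∷ b ∷ rest) →
                 Inner y → Adj T a y → y ≡ b
  maximal-head {a} {b} (u , l , _) maximal inner-y a~y with maximal inner-y a~y
  ... | here refl = ⊥-elim (adj-irrefl a~y)
  ... | there (here refl) = refl
  ... | there (there y∈rest) with ∈-∃++ y∈rest
  ...   | pre , post , refl = ⊥-elim (acyclic (close a b pre _
          (Unique-prefix (a ∷ b ∷ pre ++ [ _ ]) (subst Unique split u))
          (Linked-prefix (a ∷ b ∷ pre ++ [ _ ]) (subst (Linked (Adj T)) split l))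
          (adj-sym a~y)))
    where
    split : a ∷ b ∷ pre ++ [ _ ] ++ post ≡ a ∷ b ∷ (pre ++ [ _ ]) ++ post
    split = cong (λ t → a ∷ b ∷ t) (sym (++-assoc pre [ _ ] post))

  edge-path : ∀ {j x y} → SameEdge (ends T j) (x , y) → Inner x → Inner y → InnerPath (x ∷ y ∷ [])
  edge-path {j} x~y inner-x inner-y =
    ((λ x≡y → adj-irrefl (j , subst (λ t → SameEdge (ends T j) (_ , t)) (sym x≡y) x~y)) ∷ []) ∷ [] ∷ [] ,
    (j , x~y) ∷ [-] , inner-x ∷ inner-y ∷ []

  first-edge-reversed : ∀ {a b rest} → InnerPath (a ∷ b ∷ rest) → InnerPath (b ∷ a ∷ [])
  first-edge-reversed (_ , (j , a~b) ∷ _ , inner-a ∷ inner-b ∷ _) = edge-path (same-sym a~b) inner-b inner-a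

  head-fresh : ∀ {a xs} → InnerPath (a ∷ xs) → ∀ {z} → z ∈ₗ xs → a ≢ z
  head-fresh ((a∉ ∷ _) , _) z∈ = All.lookup a∉ z∈

  record Prolongation (b : Fin V) (rest : List (Fin V)) : Set where
    field
      head next : Fin V
      tail      : List (Fin V)
      path      : InnerPath (head ∷ next ∷ tail)
      maximal   : Maximal head (head ∷ next ∷ tail)
      keeps     : ∀ {z} → z ∈ₗ b ∷ rest → z ∈ₗ next ∷ tail

  -- greedy prolongation; fuel bounds the number of steps since paths have
  -- at most V vertices
  prolong : ∀ fuel {a b rest} → InnerPath (a ∷ b ∷ rest) → V ≤ fuel + length (a ∷ b ∷ rest) →
            Prolongation b rest
  prolong fuel {a} {b} {rest} p bound
    with any? (λ y → ¬? (leaf? y) ×-dec (adj? a y ×-dec ¬? (y ∈ₗ? (a ∷ b ∷ rest))))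
  ... | no stuck = record { path = p ; maximal = maximal ; keeps = λ z∈ → z∈ }
    where
    maximal : Maximal a (a ∷ b ∷ rest)
    maximal {y} inner-y a~y with y ∈ₗ? (a ∷ b ∷ rest)
    ... | yes y∈ = y∈
    ... | no y∉ = ⊥-elim (stuck (y , inner-y , a~y , y∉))
  ... | yes (y , inner-y , a~y , y∉) = grow fuel bound
    where
    p' : InnerPath (y ∷ a ∷ b ∷ rest)
    p' = (¬Any⇒All¬ _ y∉ ∷ proj₁ p) , (adj-sym a~y ∷ proj₁ (proj₂ p)) , (inner-y ∷ proj₂ (proj₂ p))
    grow : ∀ fuel → V ≤ fuel + length (a ∷ b ∷ rest) → Prolongation b rest
    grow zero bound = ⊥-elim (<-irrefl refl (≤-trans (unique-length (proj₁ p')) bound))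
    grow (suc fuel) bound =
      let q = prolong fuel p' (≤-trans bound (≤-reflexive (sym (+-suc fuel _)))) in
      record { Prolongation q ; keeps = Prolongation.keeps q ∘ there }

  maximal⇒outermost : ∀ {a b rest} → InnerPath (a ∷ b ∷ rest) → Maximal a (a ∷ b ∷ rest) → Outermost T a
  maximal⇒outermost {a} {b} p@(_ , (spine , a~b) ∷ _ , inner-a ∷ _) maximal = record
    { spine = spine ; twig = twig ; spine-inc = same⇒inc a~b ; twig-inc = twig-inc
    ; twig≢spine = twig≢spine ; leafy = leafy }
    where
    -- a is inner, so not every edge at a is the spine
    other : Σ (Fin k) λ j → ¬ (Inc a j → j ≡ spine)
    other = ¬∀⟶∃¬ k _ (λ j → inc? a j →-dec (j ≟ spine))
              (λ only-spine → inner-a (spine , same⇒inc a~b , only-spine))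
    twig : Fin k
    twig = proj₁ other
    twig≢spine : twig ≢ spine
    twig≢spine eq = proj₂ other (λ _ → eq)
    twig-inc : Inc a twig
    twig-inc with inc? a twig
    ... | yes i = i
    ... | no ¬i = ⊥-elim (proj₂ other (⊥-elim ∘ ¬i))
    leafy : ∀ {j y} → Inc a j → j ≢ spine → Inc y j → y ≢ a → Leaf y
    leafy {j} {y} a-j j≢spine y-j y≢a with leaf? y
    ... | yes leaf-y = leaf-y
    ... | no inner-y = ⊥-elim (j≢spine (same-edge a~y (subst (λ t → SameEdge (ends T spine) (a , t)) (sym y≡b) a~b)))
      where
      a~y : SameEdge (ends T j) (a , y)
      a~y = inc⇒same a-j y-j (y≢a ∘ sym)
      y≡b : y ≡ b
      y≡b = maximal-head p maximal inner-y (j , a~y)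

-- A tree with at least one edge that is not a star has two distinct
-- outermost inner vertices: the two ends of a maximal path of inner vertices.
-- (Abstract: only the statement is used, and unfolding the construction
-- would slow down type checking of its uses.)
abstract
  two-outermost : ∀ {V k} (T : Graph V k) → IsTree T → 1 ≤ k → ¬ IsStar T →
                  Σ (Fin V) λ w₀ → Σ (Fin V) λ w₁ → w₀ ≢ w₁ × Outermost T w₀ × Outermost T w₁
  two-outermost {V} {k} T (conn , acyclic) 1≤k not-star =
    head first , head second , head-fresh (path second) (keeps second (here refl)) ∘ sym ,
    maximal⇒outermost (path first) (maximal first) , maximal⇒outermost (path second) (maximal second)
    where
    open InnerPaths T acyclic
    open Prolongation
    inner : Σ (Fin k) λ j → Incidence.Inner T (proj₁ (ends T j)) × Incidence.Inner T (proj₂ (ends T j))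
    inner = Stars.inner-edge T conn 1≤k not-star
    -- prolong an inner edge at one end, then prolong the last edge reached
    -- at its other end
    first : Prolongation (proj₂ (ends T (proj₁ inner))) []
    first = prolong V (edge-path (inj₁ (refl , refl)) (proj₁ (proj₂ inner)) (proj₂ (proj₂ inner))) (m≤m+n V _)
    second : Prolongation (head first) []
    second = prolong V (first-edge-reversed (path first)) (m≤m+n V _)

half-bound : ∀ {k δ} → 1 ≤ k → δ + δ ≤ suc k → δ ≤ suc ((k ∸ 1) / 2)
half-bound {suc t} {δ} _ 2δ≤ = begin
  δ                 ≡⟨ m*n/n≡m δ 2 ⟨
  δ * 2 / 2         ≤⟨ /-monoˡ-≤ {δ * 2} {suc (suc t)} 2 (≤-trans (≤-reflexive δ*2≡δ+δ) 2δ≤) ⟩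
  suc (suc t) / 2   ≡⟨ m/n≡1+[m∸n]/n {suc (suc t)} {2} (s≤s (s≤s z≤n)) ⟩
  suc (t / 2)       ∎
  where
  open ≤-Reasoning
  δ*2≡δ+δ : δ * 2 ≡ δ + δ
  δ*2≡δ+δ = trans (*-comm δ 2) (cong (δ +_) (+-identityʳ δ))

module TreeCounting {V k : ℕ} (T : Graph V k) where
  open Incidence T

  edgesAt : Fin V → Subset k
  edgesAt x = ⟦ inc? x ⟧

  leaves : Subset V
  leaves = ⟦ leaf? ⟧

  -- two distinct vertices share at most one edge, so their degrees sum to
  -- at most k + 1
  degree-sum : ∀ {x y} → x ≢ y → ∣ edgesAt x ∣ + ∣ edgesAt y ∣ ≤ suc k
  degree-sum {x} {y} x≢y = begin
    ∣ edgesAt x ∣ + ∣ edgesAt y ∣ ≡⟨ ∣p∪q∣+∣p∩q∣≡∣p∣+∣q∣ (edgesAt x) (edgesAt y) ⟨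
    ∣ edgesAt x ∪ edgesAt y ∣ + ∣ edgesAt x ∩ edgesAt y ∣ ≤⟨ +-mono-≤ (∣p∣≤n (edgesAt x ∪ edgesAt y)) (∣p∣≤1 (edgesAt x ∩ edgesAt y) shared) ⟩
    k + 1 ≡⟨ +-comm k 1 ⟩
    suc k ∎
    where
    open ≤-Reasoning
    joins : ∀ {j} → j ∈ edgesAt x ∩ edgesAt y → SameEdge (ends T j) (x , y)
    joins j∈ with x∈p∩q⁻ (edgesAt x) (edgesAt y) j∈
    ... | j∈x , j∈y = inc⇒same (∈⟦⟧⁻ (inc? x) j∈x) (∈⟦⟧⁻ (inc? y) j∈y) x≢y
    shared : ∀ {i j} → i ∈ edgesAt x ∩ edgesAt y → j ∈ edgesAt x ∩ edgesAt y → i ≡ j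
    shared i∈ j∈ = same-edge (joins i∈) (joins j∈)

  -- distinct outermost vertices have distinct twig leaves: a common one
  -- would be a third end of its only edge
  two-leaves : ∀ {w₀ w₁} → w₀ ≢ w₁ → Outermost T w₀ → Outermost T w₁ → 2 ≤ ∣ leaves ∣
  two-leaves {w₀} {w₁} w₀≢w₁ o₀ o₁ with twig-leaf o₀ | twig-leaf o₁
  ... | z₀ , z₀-inc , z₀≢w₀ , leaf₀ | z₁ , z₁-inc , z₁≢w₁ , leaf₁ =
    2≤∣p∣ (∈⟦⟧⁺ leaf? leaf₀) (∈⟦⟧⁺ leaf? leaf₁) z₀≢z₁
    where
    z₀≢z₁ : z₀ ≢ z₁
    z₀≢z₁ refl with leaf-edge leaf₀ z₀-inc z₁-inc
    ... | refl with third-endpoint (Outermost.twig-inc o₀) z₀-inc (z₀≢w₀ ∘ sym) (Outermost.twig-inc o₁)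
    ...   | inj₁ w₁≡w₀ = w₀≢w₁ (sym w₁≡w₀)
    ...   | inj₂ w₁≡z₀ = z₁≢w₁ (sym w₁≡z₀)

  low-outermost : IsTree T → 1 ≤ k → ¬ IsStar T →
                  2 ≤ ∣ leaves ∣ × Σ (Fin V) λ w → Outermost T w × ∣ edgesAt w ∣ ≤ suc ((k ∸ 1) / 2)
  low-outermost tree 1≤k not-star with two-outermost T tree 1≤k not-star
  ... | w₀ , w₁ , w₀≢w₁ , o₀ , o₁ = two-leaves w₀≢w₁ o₀ o₁ , smaller (∣ edgesAt w₀ ∣ ≤? ∣ edgesAt w₁ ∣)
    where
    smaller : Dec (∣ edgesAt w₀ ∣ ≤ ∣ edgesAt w₁ ∣) → Σ (Fin V) λ w → Outermost T w × ∣ edgesAt w ∣ ≤ suc ((k ∸ 1) / 2)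
    smaller (yes d₀≤d₁) = w₀ , o₀ , half-bound 1≤k (≤-trans (+-monoʳ-≤ _ d₀≤d₁) (degree-sum w₀≢w₁))
    smaller (no d₀≰d₁) = w₁ , o₁ , half-bound 1≤k (≤-trans (+-mono-≤ (<⇒≤ (≰⇒> d₀≰d₁)) ≤-refl) (degree-sum w₀≢w₁))

module Embedding
  {n k r : ℕ} (1≤k : 1 ≤ k) (k+1≤r : k + 1 ≤ r)
  {V : ℕ} (T : Graph V k) (tree : IsTree T) (not-star : ¬ IsStar T)
  {m : ℕ} (H : Hypergraph n m) (uniform : Uniform r H)
  {S : Subset m} {C : Subset n} (∣S∣≡k-1 : ∣ S ∣ ≡ k ∸ 1) (k-1≤∣C∣ : k ∸ 1 ≤ ∣ C ∣) (core⊆ : ∀ j → j ∈ S → C ⊆ H j)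
  {v : Fin n} {e h : Fin m} (e∈S : e ∈ S) (v∈e : v ∈ H e) (h∉S : h ∉ S) (v∈h : v ∈ H h)
  (high : suc ((k ∸ 1) / 2) ≤ degree H v)
  where

  open Incidence T
  open TreeCounting T

  -- w is an outermost inner vertex of T of degree at most ⌊(k - 1)/2⌋ + 1;
  -- it will be placed at v. (The choices made here and below are abstract:
  -- only their specifications are used.)
  abstract
    chosen : 2 ≤ ∣ leaves ∣ × Σ (Fin V) λ w → Outermost T w × ∣ edgesAt w ∣ ≤ suc ((k ∸ 1) / 2)
    chosen = low-outermost tree 1≤k not-star

  2≤∣leaves∣ : 2 ≤ ∣ leaves ∣
  2≤∣leaves∣ = proj₁ chosen

  w : Fin V
  w = proj₁ (proj₂ chosen)

  w-outermost : Outermost T w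
  w-outermost = proj₁ (proj₂ (proj₂ chosen))

  open Outermost w-outermost

  W : Subset k
  W = edgesAt w

  D : Subset m
  D = ⟦ (λ j → v ∈? H j) ⟧

  ∣W∣≤∣D∣ : ∣ W ∣ ≤ ∣ D ∣
  ∣W∣≤∣D∣ = ≤-trans (proj₂ (proj₂ (proj₂ chosen))) high

  -- Edges. The spine goes to e ∈ S, the twig to h ∉ S, the other edges at
  -- w to further hyperedges at v, and edges away from w to members of S.
  spine∈W : spine ∈ W
  spine∈W = ∈⟦⟧⁺ (inc? w) spine-inc

  P₂ : Subset k
  P₂ = W - spine - twig

  2+∣P₂∣≤∣W∣ : 2 + ∣ P₂ ∣ ≤ ∣ W ∣
  2+∣P₂∣≤∣W∣ = ≤-trans (s≤s (x∈p⇒∣p-x∣<∣p∣ twig∈W-spine)) (x∈p⇒∣p-x∣<∣p∣ spine∈W)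
    where
    twig∈W-spine : twig ∈ W - spine
    twig∈W-spine = x∈p∧x≢y⇒x∈p-y (∈⟦⟧⁺ (inc? w) twig-inc) twig≢spine

  X₂ : Subset m
  X₂ = ⁅ e ⁆ ∪ ⁅ h ⁆

  abstract
    reps₂ : Representatives P₂ (λ _ → D) X₂
    reps₂ = representatives e P₂ (λ _ → D) X₂ λ _ → +-cancelʳ-≤ 2 _ _ (begin
      ∣ P₂ ∣ + 2            ≡⟨ +-comm ∣ P₂ ∣ 2 ⟩
      2 + ∣ P₂ ∣            ≤⟨ ≤-trans 2+∣P₂∣≤∣W∣ ∣W∣≤∣D∣ ⟩
      ∣ D ∣                 ≤⟨ ∣p∣≤∣p─q∣+∣q∣ D X₂ ⟩
      ∣ D ─ X₂ ∣ + ∣ X₂ ∣   ≤⟨ +-monoʳ-≤ ∣ D ─ X₂ ∣ (∣⁅x⁆∪p∣≤1+∣p∣ e ⁅ h ⁆) ⟩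
      ∣ D ─ X₂ ∣ + suc ∣ ⁅ h ⁆ ∣ ≡⟨ cong (λ t → ∣ D ─ X₂ ∣ + suc t) (∣⁅x⁆∣≡1 h) ⟩
      ∣ D ─ X₂ ∣ + 2        ∎)
      where open ≤-Reasoning

  module R₂ = Representatives reps₂

  X₃ : Subset m
  X₃ = ⁅ e ⁆ ∪ R₂.used

  abstract
    reps₃ : Representatives (∁ W) (λ _ → S) X₃
    reps₃ = representatives e (∁ W) (λ _ → S) X₃ λ _ → begin
      ∣ ∁ W ∣                   ≡⟨ ∣∁p∣≡n∸∣p∣ W ⟩
      k ∸ ∣ W ∣                 ≤⟨ ∸-monoʳ-≤ k 2+∣P₂∣≤∣W∣ ⟩
      k ∸ (2 + ∣ P₂ ∣)          ≡⟨ ∸-+-assoc k 1 (suc ∣ P₂ ∣) ⟨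
      (k ∸ 1) ∸ suc ∣ P₂ ∣      ≤⟨ ∸-monoʳ-≤ (k ∸ 1) ∣X₃∣≤1+∣P₂∣ ⟩
      (k ∸ 1) ∸ ∣ X₃ ∣          ≤⟨ m≤n+o⇒m∸n≤o (k ∸ 1) ∣ X₃ ∣ S-split ⟩
      ∣ S ─ X₃ ∣                ∎
      where
      open ≤-Reasoning
      ∣X₃∣≤1+∣P₂∣ : ∣ X₃ ∣ ≤ suc ∣ P₂ ∣
      ∣X₃∣≤1+∣P₂∣ = ≤-trans (∣⁅x⁆∪p∣≤1+∣p∣ e _) (s≤s R₂.∣used∣≤∣P∣)
      S-split : k ∸ 1 ≤ ∣ X₃ ∣ + ∣ S ─ X₃ ∣
      S-split = subst (_≤ ∣ X₃ ∣ + ∣ S ─ X₃ ∣) ∣S∣≡k-1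
                  (≤-trans (∣p∣≤∣p─q∣+∣q∣ S X₃) (≤-reflexive (+-comm _ ∣ X₃ ∣)))

  module R₃ = Representatives reps₃

  atW : Fin k → Fin m
  atW = glue (_≟ spine) (λ _ → e) (glue (_≟ twig) (λ _ → h) R₂.pick)

  f₂ : Fin k → Fin m
  f₂ = glue (_∈? W) atW R₃.pick

  ∈P₂ : ∀ {j} → j ∈ W → j ≢ spine → j ≢ twig → j ∈ P₂
  ∈P₂ j∈W j≢spine j≢twig = x∈p∧x≢y⇒x∈p-y (x∈p∧x≢y⇒x∈p-y j∈W j≢spine) j≢twig

  v∈f₂ : ∀ {j} → j ∈ W → v ∈ H (f₂ j)
  v∈f₂ {j} j∈W with j ∈? W
  ... | no j∉W = ⊥-elim (j∉W j∈W)
  ... | yes _ with j ≟ spine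
  ...   | yes _ = v∈e
  ...   | no j≢spine with j ≟ twig
  ...     | yes _ = v∈h
  ...     | no j≢twig = ∈⟦⟧⁻ (λ i → v ∈? H i) (R₂.pick∈Q (∈P₂ j∈W j≢spine j≢twig))

  f₂∈S : ∀ {j} → j ≡ spine ⊎ j ∉ W → f₂ j ∈ S
  f₂∈S {j} where-j with j ∈? W
  ... | no j∉W = R₃.pick∈Q (x∉p⇒x∈∁p j∉W)
  ... | yes j∈W with j ≟ spine | where-j
  ...   | yes _ | _ = e∈S
  ...   | no j≢spine | inj₁ j≡spine = ⊥-elim (j≢spine j≡spine)
  ...   | no _ | inj₂ j∉W = ⊥-elim (j∉W j∈W)

  e∈X₂ : e ∈ X₂
  e∈X₂ = p⊆p∪q ⁅ h ⁆ (x∈⁅x⁆ e)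

  h∈X₂ : h ∈ X₂
  h∈X₂ = q⊆p∪q ⁅ e ⁆ ⁅ h ⁆ (x∈⁅x⁆ h)

  -- images of edges at w are e, h, or used by R₂, hence not chosen by R₃
  atW-apart : ∀ {i j} → i ∈ W → j ∉ W → atW i ≢ R₃.pick j
  atW-apart {i} {j} i∈W j∉W eq with i ≟ spine
  ... | yes _ = R₃.pick∉X (x∉p⇒x∈∁p j∉W) (subst (_∈ X₃) eq (p⊆p∪q _ (x∈⁅x⁆ e)))
  ... | no i≢spine with i ≟ twig
  ...   | yes _ = h∉S (subst (_∈ S) (sym eq) (R₃.pick∈Q (x∉p⇒x∈∁p j∉W)))
  ...   | no i≢twig = R₃.pick∉X (x∉p⇒x∈∁p j∉W)
                        (subst (_∈ X₃) eq (q⊆p∪q ⁅ e ⁆ _ (R₂.pick∈used (∈P₂ i∈W i≢spine i≢twig))))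

  f₂-injective : ∀ {i j} → f₂ i ≡ f₂ j → i ≡ j
  f₂-injective = glue-injective (_∈? W) {D = λ _ → ⊤} atW-injective R₃-injective (λ _ i∈W _ j∉W → atW-apart i∈W j∉W) tt tt
    where
    R₃-injective : InjectiveOn (λ x → ⊤ × x ∉ W) R₃.pick
    R₃-injective (_ , i∉W) (_ , j∉W) = R₃.pick-injective (x∉p⇒x∈∁p i∉W) (x∉p⇒x∈∁p j∉W)
    atW-injective : InjectiveOn (λ x → ⊤ × x ∈ W) atW
    atW-injective = glue-injective (_≟ spine) (λ { (_ , refl) (_ , refl) _ → refl }) rest-injective
                      λ _ _ (_ , j∈W) j≢spine → e-apart j∈W j≢spine
      where
      e-apart : ∀ {j} → j ∈ W → j ≢ spine → e ≢ glue (_≟ twig) (λ _ → h) R₂.pick j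
      e-apart {j} j∈W j≢spine eq with j ≟ twig
      ... | yes _ = h∉S (subst (_∈ S) eq e∈S)
      ... | no j≢twig = R₂.pick∉X (∈P₂ j∈W j≢spine j≢twig) (subst (_∈ X₂) eq e∈X₂)
      rest-injective : InjectiveOn (λ x → (⊤ × x ∈ W) × x ≢ spine) (glue (_≟ twig) (λ _ → h) R₂.pick)
      rest-injective = glue-injective (_≟ twig) (λ { (_ , refl) (_ , refl) _ → refl })
        (λ { (((_ , i∈W) , i≢s) , i≢t) (((_ , j∈W) , j≢s) , j≢t) → R₂.pick-injective (∈P₂ i∈W i≢s i≢t) (∈P₂ j∈W j≢s j≢t) })
        λ { _ _ (((_ , j∈W) , j≢s)) j≢t eq → R₂.pick∉X (∈P₂ j∈W j≢s j≢t) (subst (_∈ X₂) eq h∈X₂) }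

  -- Vertices. w goes to v, the other inner vertices into the core C, and
  -- each leaf into the image of its edge, all distinct.
  L : Subset V
  L = leaves

  N : Subset V
  N = ∁ L - w

  w∈∁L : w ∈ ∁ L
  w∈∁L = x∉p⇒x∈∁p (outermost-inner w-outermost ∘ ∈⟦⟧⁻ leaf?)

  ∈N : ∀ {x} → x ≢ w → Inner x → x ∈ N
  ∈N x≢w inner-x = x∈p∧x≢y⇒x∈p-y (x∉p⇒x∈∁p (inner-x ∘ ∈⟦⟧⁻ leaf?)) x≢w

  -- the leaves, w and the other inner vertices are all the vertices
  ∣L∣+1+∣N∣≤V : ∣ L ∣ + suc ∣ N ∣ ≤ V
  ∣L∣+1+∣N∣≤V = begin
    ∣ L ∣ + suc ∣ N ∣ ≤⟨ +-monoʳ-≤ ∣ L ∣ (x∈p⇒∣p-x∣<∣p∣ w∈∁L) ⟩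
    ∣ L ∣ + ∣ ∁ L ∣   ≡⟨ cong (∣ L ∣ +_) (∣∁p∣≡n∸∣p∣ L) ⟩
    ∣ L ∣ + (V ∸ ∣ L ∣) ≡⟨ m+[n∸m]≡n (∣p∣≤n L) ⟩
    V ∎
    where open ≤-Reasoning

  V≤1+k : V ≤ suc k
  V≤1+k = vertices≤edges+1 T (proj₁ tree) w

  abstract
    reps₄ : Representatives N (λ _ → C) ⁅ v ⁆
    reps₄ = representatives v N (λ _ → C) ⁅ v ⁆ λ _ → +-cancelʳ-≤ 2 _ _ (begin
      ∣ N ∣ + 2              ≤⟨ +-monoʳ-≤ ∣ N ∣ 2≤∣leaves∣ ⟩
      ∣ N ∣ + ∣ L ∣          ≤⟨ ≤-pred (≤-trans (≤-reflexive N+L) (≤-trans ∣L∣+1+∣N∣≤V V≤1+k)) ⟩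
      k                      ≡⟨ m∸n+n≡m 1≤k ⟨
      (k ∸ 1) + 1            ≤⟨ +-monoˡ-≤ 1 (≤-trans k-1≤∣C∣ (∣p∣≤∣p─q∣+∣q∣ C ⁅ v ⁆)) ⟩
      ∣ C ─ ⁅ v ⁆ ∣ + ∣ ⁅ v ⁆ ∣ + 1 ≡⟨ cong (λ t → ∣ C ─ ⁅ v ⁆ ∣ + t + 1) (∣⁅x⁆∣≡1 v) ⟩
      ∣ C ─ ⁅ v ⁆ ∣ + 1 + 1  ≡⟨ +-assoc ∣ C ─ ⁅ v ⁆ ∣ 1 1 ⟩
      ∣ C ─ ⁅ v ⁆ ∣ + 2      ∎)
      where
      open ≤-Reasoning
      N+L : suc (∣ N ∣ + ∣ L ∣) ≡ ∣ L ∣ + suc ∣ N ∣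
      N+L = trans (cong suc (+-comm ∣ N ∣ ∣ L ∣)) (sym (+-suc ∣ L ∣ ∣ N ∣))

  module R₄ = Representatives reps₄

  X₅ : Subset n
  X₅ = ⁅ v ⁆ ∪ R₄.used

  -- the edge of a leaf (irrelevant for other vertices)
  leafEdge : Fin V → Fin k
  leafEdge x with leaf? x
  ... | yes (j , _) = j
  ... | no _ = spine

  leafEdge-inc : ∀ {x j} → Leaf x → Inc x j → leafEdge x ≡ j
  leafEdge-inc {x} leaf-x x-j with leaf? x
  ... | yes (_ , _ , unique) = sym (unique _ x-j)
  ... | no inner-x = ⊥-elim (inner-x leaf-x)

  abstract
    reps₅ : Representatives L (λ x → H (f₂ (leafEdge x))) X₅
    reps₅ = representatives v L (λ x → H (f₂ (leafEdge x))) X₅ λ {x} _ → +-cancelʳ-≤ (suc ∣ N ∣) _ _ (begin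
      ∣ L ∣ + suc ∣ N ∣                 ≤⟨ ≤-trans ∣L∣+1+∣N∣≤V V≤1+k ⟩
      suc k                             ≡⟨ +-comm 1 k ⟩
      k + 1                             ≤⟨ k+1≤r ⟩
      r                                 ≡⟨ uniform (f₂ (leafEdge x)) ⟨
      ∣ H (f₂ (leafEdge x)) ∣           ≤⟨ ∣p∣≤∣p─q∣+∣q∣ (H (f₂ (leafEdge x))) X₅ ⟩
      ∣ H (f₂ (leafEdge x)) ─ X₅ ∣ + ∣ X₅ ∣ ≤⟨ +-monoʳ-≤ _ (≤-trans (∣⁅x⁆∪p∣≤1+∣p∣ v R₄.used) (s≤s R₄.∣used∣≤∣P∣)) ⟩
      ∣ H (f₂ (leafEdge x)) ─ X₅ ∣ + suc ∣ N ∣ ∎)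
      where open ≤-Reasoning

  module R₅ = Representatives reps₅

  f₁ : Fin V → Fin n
  f₁ = glue (_≟ w) (λ _ → v) (glue leaf? R₅.pick R₄.pick)

  v∈X₅ : v ∈ X₅
  v∈X₅ = p⊆p∪q R₄.used (x∈⁅x⁆ v)

  f₁-injective : ∀ {x y} → f₁ x ≡ f₁ y → x ≡ y
  f₁-injective = glue-injective (_≟ w) {D = λ _ → ⊤} (λ { (_ , refl) (_ , refl) _ → refl }) rest-injective
                   (λ _ _ _ y≢w → v-apart y≢w) tt tt
    where
    rest-injective : InjectiveOn (λ x → ⊤ × x ≢ w) (glue leaf? R₅.pick R₄.pick)
    rest-injective = glue-injective leaf?
      (λ (_ , leaf-x) (_ , leaf-y) → R₅.pick-injective (∈⟦⟧⁺ leaf? leaf-x) (∈⟦⟧⁺ leaf? leaf-y))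
      (λ ((_ , x≢w) , inner-x) ((_ , y≢w) , inner-y) → R₄.pick-injective (∈N x≢w inner-x) (∈N y≢w inner-y))
      λ _ leaf-x (_ , y≢w) inner-y eq →
        R₅.pick∉X (∈⟦⟧⁺ leaf? leaf-x) (subst (_∈ X₅) (sym eq) (q⊆p∪q ⁅ v ⁆ _ (R₄.pick∈used (∈N y≢w inner-y))))
    v-apart : ∀ {y} → y ≢ w → v ≢ glue leaf? R₅.pick R₄.pick y
    v-apart {y} y≢w eq with leaf? y
    ... | yes leaf-y = R₅.pick∉X (∈⟦⟧⁺ leaf? leaf-y) (subst (_∈ X₅) eq v∈X₅)
    ... | no inner-y = R₄.pick∉X (∈N y≢w inner-y) (subst (_∈ ⁅ v ⁆) eq (x∈⁅x⁆ v))

  endpoint : ∀ {x j} → Inc x j → f₁ x ∈ H (f₂ j)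
  endpoint {x} {j} x-j with x ≟ w
  ... | yes refl = v∈f₂ (∈⟦⟧⁺ (inc? w) x-j)
  ... | no x≢w with leaf? x
  ...   | yes leaf-x = subst (λ i → R₅.pick x ∈ H (f₂ i)) (leafEdge-inc leaf-x x-j) (R₅.pick∈Q (∈⟦⟧⁺ leaf? leaf-x))
  ...   | no inner-x = core⊆ (f₂ j) (f₂∈S away) (R₄.pick∈Q (∈N x≢w inner-x))
    where
    -- an edge at w other than the spine leads to a leaf, so j is not one
    away : j ≡ spine ⊎ j ∉ W
    away with j ≟ spine | j ∈? W
    ... | yes j≡spine | _ = inj₁ j≡spine
    ... | no _ | no j∉W = inj₂ j∉W
    ... | no j≢spine | yes j∈W = ⊥-elim (inner-x (leafy (∈⟦⟧⁻ (inc? w) j∈W) j≢spine x-j x≢w))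

  berge : BergeCopy T H
  berge = f₁ , f₂ , f₁-injective , f₂-injective , λ j → endpoint (inj₁ refl) , endpoint (inj₂ refl)

claim3 : (n k r : ℕ) → 1 ≤ n → 1 ≤ k → 1 ≤ r → k + 1 ≤ r →
         (V : ℕ) (T : Graph V k) → IsTree T → ¬ IsStar T →
         (m : ℕ) (H : Hypergraph n m) → Uniform r H → ¬ BergeCopy T H →
         (S : Subset m) → IsCluster (k ∸ 1) H S →
         (v : Fin n) → InSpan H S v → (∃[ j ] (j ∉ S × v ∈ H j)) →
         degree H v ≤ (k ∸ 1) / 2
claim3 n k r _ 1≤k _ k+1≤r V T tree not-star m H uniform no-copy S (∣S∣≡k-1 , C , k-1≤∣C∣ , core⊆) v
       (e , e∈S , v∈e) (h , h∉S , v∈h) with degree H v ≤? (k ∸ 1) / 2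
... | yes low = low
... | no ¬low = ⊥-elim (no-copy (Embedding.berge 1≤k k+1≤r T tree not-star H uniform ∣S∣≡k-1 k-1≤∣C∣ core⊆
                                   e∈S v∈e h∉S v∈h (≰⇒> ¬low)))
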